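{- For $n\in\mathbb N$, let $\mathrm{KBKF}_n = P_n.\phi_n$ be the QBF defined in the context, and let $\psi_n = (\bar x_1\lor y_1)\land\cdots\land(\bar x_n\lor y_n)$. Then the QBF $P_n.(\phi_n\land\psi_n)$ (with the same prefix $P_n$ and the clauses of $\psi_n$ added to those of $\phi_n$) has a Q-Res refutation with no more than $4n$ steps.
   Context: A QBF is $P.\phi$ with $\phi$ a CNF (a conjunction of clauses, each clause a set/disjunction of literals $x$ or $\bar x$) and $P=Q_1x_1\cdots Q_mx_m$ a quantifier prefix with $Q_i\in\{\forall,\exists\}$; the prefix orders variables by $x_i<_P x_j$ iff $i<j$. The Q-Res calculus on $P.\phi$ has the rules: (A) any clause of $\phi$ may be derived; (R) from derived clauses $C\lor x$ and $C'\lor\bar x$, with $x$ existentially quantified and $C\cup C'$ not a tautology, derive $C\lor C'$; (U) from a derived clause $C\lor l$ with $l$ a universal literal, $\bar l\notin C$, and every existential literal $k\in C$ satisfying $k<_P l$, derive $C$. A refutation is a sequence of applications of R and U deriving the empty clause; steps are counted as applications of R and U (axiom uses A are not counted). $\mathrm{KBKF}_n$ has prefix $\exists x_1y_1\forall a_1\exists x_2y_2\forall a_2\dots\exists x_ny_n\forall a_n\exists z_1\dots z_n$ and clauses: $C_1=(\bar x_1\lor\bar y_1)$; for $j=1,\dots,n-1$: $C_{2j}=(x_j\lor\bar a_j\lor\bar x_{j+1}\lor\bar y_{j+1})$ and $C_{2j+1}=(y_j\lor a_j\lor\bar x_{j+1}\lor\bar y_{j+1})$; $C_{2n}=(x_n\lor\bar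 a_n\lor\bar z_1\lor\dots\lor\bar z_n)$, $C_{2n+1}=(y_n\lor a_n\lor\bar z_1\lor\dots\lor\bar z_n)$; for $j=1,\dots,n$: $B_{2j-1}=(a_j\lor z_j)$ and $B_{2j}=(\bar a_j\lor z_j)$. -}

module Defs where

open import Data.Nat using (ℕ; zero; suc; _+_; _*_; _∸_; _<_; _≡ᵇ_)
open import Data.Bool using (Bool; true; false; _∧_; _∨_; not)
open import Data.List using (List; []; _∷_; _++_; map; concatMap; upTo; replicate)
open import Data.Bool.ListAction using (any)
open import Data.List.Membership.Propositional using (_∈_)
open import Data.List.Relation.Unary.Any using (Any)
open import Data.Maybe using (Maybe; just; nothing)
open import Data.Product using (Σ; _×_; _,_)
open import Data.Sum using (_⊎_)
open import Relation.Binary.PropositionalEquality using (_≡_)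
open import Relation.Nullary using (¬_)

-- A prefix  Q₀ v₀ Q₁ v₁ ⋯ Q_{m-1} v_{m-1}
-- is a list of quantifiers; variable v is bound by the v-th quantifier,
-- so the prefix order  v <_P w  is just  v < w  on ℕ.

data Quant : Set where
  ∀q ∃q : Quant

Prefix : Set
Prefix = List Quant

quantOf : Prefix → ℕ → Maybe Quant
quantOf []       _       = nothing
quantOf (q ∷ _)  zero    = just q
quantOf (_ ∷ qs) (suc v) = quantOf qs v

data Lit : Set where
  pos neg : ℕ → Lit

var : Lit → ℕ
var (pos v) = v
var (neg v) = v

comp : Lit → Lit
comp (pos v) = neg v
comp (neg v) = pos v

_==_ : Lit → Lit → Bool
pos v == pos w = v ≡ᵇ w
neg v == neg w = v ≡ᵇ w
_     == _     = false

InClause : Set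
InClause = List Lit

CNF : Set
CNF = List InClause

Clause : Set
Clause = Lit → Bool

⟦_⟧ : InClause → Clause
⟦ ls ⟧ l = any (λ k → l == k) ls

_≗_ : Clause → Clause → Set
C ≗ D = ∀ l → C l ≡ D l

Tautology : Clause → Set
Tautology C = Σ ℕ λ v → (C (pos v) ≡ true) × (C (neg v) ≡ true)

Empty : Clause → Set
Empty C = ∀ l → C l ≡ false

resolvent : Clause → Clause → ℕ → Clause
resolvent C₁ C₂ x l = (C₁ l ∧ not (l == pos x)) ∨ (C₂ l ∧ not (l == neg x))

remove : Clause → Lit → Clause
remove C k l = C l ∧ not (l == k)

-- A derivation is a sequence of clauses (stored most recent
-- first), each justified by rule A, R or U from the clauses before it.
-- The index counts the applications of R and U (A is not counted).

data Deriv (P : Prefix) (φ : CNF) : List Clause → ℕ → Set where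
  []  : Deriv P φ [] 0
  axm : ∀ {cs k} (C : Clause) → Deriv P φ cs k →
        (Σ InClause λ D → (D ∈ φ) × (C ≗ ⟦ D ⟧)) →
        Deriv P φ (C ∷ cs) k
  res : ∀ {cs k} (C : Clause) → Deriv P φ cs k →
        (C₁ C₂ : Clause) (x : ℕ) →
        C₁ ∈ cs → C₂ ∈ cs →
        quantOf P x ≡ just ∃q →
        C₁ (pos x) ≡ true → C₂ (neg x) ≡ true →
        ¬ Tautology (resolvent C₁ C₂ x) →
        C ≗ resolvent C₁ C₂ x →
        Deriv P φ (C ∷ cs) (suc k)
  red : ∀ {cs k} (C : Clause) → Deriv P φ cs k →
        (C₁ : Clause) (l : Lit) →
        C₁ ∈ cs →
        quantOf P (var l) ≡ just ∀q →
        C₁ l ≡ true →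
        C₁ (comp l) ≡ false →
        (∀ k → quantOf P (var k) ≡ just ∃q →
               remove C₁ l k ≡ true → var k < var l) →
        C ≗ remove C₁ l →
        Deriv P φ (C ∷ cs) (suc k)

Refutation : Prefix → CNF → ℕ → Set
Refutation P φ s = Σ (List Clause) λ cs → Deriv P φ cs s × Any Empty cs

-- KBKF_n  (0-based block index i = j - 1).
-- Variable numbering following the prefix
--   ∃x₁y₁ ∀a₁ ∃x₂y₂ ∀a₂ ⋯ ∃xₙyₙ ∀aₙ ∃z₁⋯zₙ :
-- x_{i+1} ↦ 3i, y_{i+1} ↦ 3i+1, a_{i+1} ↦ 3i+2, z_{i+1} ↦ 3n+i.

xv yv av : ℕ → ℕ
xv i = 3 * i
yv i = 3 * i + 1
av i = 3 * i + 2

zv : ℕ → ℕ → ℕ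
zv n i = 3 * n + i

kbkfPrefix : ℕ → Prefix
kbkfPrefix n = concatMap (λ _ → ∃q ∷ ∃q ∷ ∀q ∷ []) (upTo n) ++ replicate n ∃q

negZs : ℕ → List Lit
negZs n = map (λ i → neg (zv n i)) (upTo n)

kbkfMatrix : ℕ → CNF
kbkfMatrix n =
  (neg (xv 0) ∷ neg (yv 0) ∷ [])
  ∷ concatMap (λ i →
        (pos (xv i) ∷ neg (av i) ∷ neg (xv (suc i)) ∷ neg (yv (suc i)) ∷ [])
      ∷ (pos (yv i) ∷ pos (av i) ∷ neg (xv (suc i)) ∷ neg (yv (suc i)) ∷ [])
      ∷ []) (upTo (n ∸ 1))
  ++ (pos (xv (n ∸ 1)) ∷ neg (av (n ∸ 1)) ∷ negZs n)
  ∷ (pos (yv (n ∸ 1)) ∷ pos (av (n ∸ 1)) ∷ negZs n)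
  ∷ concatMap (λ i →
        (pos (av i) ∷ pos (zv n i) ∷ [])
      ∷ (neg (av i) ∷ pos (zv n i) ∷ [])
      ∷ []) (upTo n)

psi : ℕ → CNF
psi n = map (λ i → neg (xv i) ∷ pos (yv i) ∷ []) (upTo n)

-- Resolving C_{2n} with B_2, B_4, …, B_{2n} removes every z (n steps) and leaves x_n ∨ ā_1 ∨ ⋯ ∨ ā_n,
-- from which ā_n is reduced, as x_n is its only existential literal. Then, for j = n-1, …, 1, the extra
-- clause ψ_{j+1} resolves with C_{2j} on y_{j+1} to x_j ∨ ā_j ∨ x̄_{j+1}; resolving this with
-- x_{j+1} ∨ ā_1 ∨ ⋯ ∨ ā_j on x_{j+1} and reducing ā_j gives x_j ∨ ā_1 ∨ ⋯ ∨ ā_{j-1} (3 steps).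
-- Finally ψ_1 and C_1 resolve to x̄_1, which cancels x_1: n + 1 + 3(n-1) + 2 = 4n steps.
-- Clauses are only tracked up to an upper bound on their literals plus the few literals that must
-- be present; the bound is what rules out tautologies and justifies each reduction.

module Submission where

open import Defs
open import Data.Bool using (true; false; _∧_; not)
open import Data.Bool.Properties using (T-≡)
open import Data.Empty using (⊥; ⊥-elim)
open import Data.List using (List; []; _∷_; _++_; length; concatMap; replicate; upTo)
open import Data.List.Membership.Propositional using (_∈_; lose)
open import Data.List.Membership.Propositional.Properties
  using (∈-++⁺ˡ; ∈-++⁺ʳ; ∈-map⁺; ∈-map⁻; ∈-concatMap⁺; ∈-upTo⁺; ∈-upTo⁻)
open import Data.List.Properties using (length-upTo; ++-assoc)
open import Data.List.Relation.Unary.Any using (here; there)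
import Data.List.Relation.Unary.Any as Any
open import Data.Maybe using (just)
open import Data.Nat using (ℕ; zero; suc; _+_; _*_; _≤_; _<_; z≤n; s≤s; z<s; s<s)
open import Data.Nat.Properties
open import Data.Nat.Tactic.RingSolver using (solve-∀)
open import Data.Product using (Σ; ∃-syntax; _×_; _,_; proj₂)
open import Data.Sum using (_⊎_; inj₁; inj₂)
open import Function using (Equivalence)
open import Relation.Binary.Definitions using (tri<; tri≈; tri>)
open import Relation.Binary.PropositionalEquality
open import Relation.Nullary using (¬_)

neg-injective : ∀ {v w} → neg v ≡ neg w → v ≡ w
neg-injective refl = refl

==-refl : ∀ l → (l == l) ≡ true
==-refl (pos v) = Equivalence.to T-≡ (≡⇒≡ᵇ v v refl)
==-refl (neg v) = Equivalence.to T-≡ (≡⇒≡ᵇ v v refl)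

==⇒≡ : ∀ l k → (l == k) ≡ true → l ≡ k
==⇒≡ (pos v) (pos w) eq = cong pos (≡ᵇ⇒≡ v w (Equivalence.from T-≡ eq))
==⇒≡ (neg v) (neg w) eq = cong neg (≡ᵇ⇒≡ v w (Equivalence.from T-≡ eq))

==-false⇒≢ : ∀ {l k} → (l == k) ≡ false → l ≢ k
==-false⇒≢ {l} eq refl with () ← trans (sym eq) (==-refl l)

≢⇒==-false : ∀ l k → l ≢ k → (l == k) ≡ false
≢⇒==-false l k l≢k with l == k in eq
... | true  = ⊥-elim (l≢k (==⇒≡ l k eq))
... | false = refl

_⊆_ : Clause → (Lit → Set) → Set
C ⊆ S = ∀ l → C l ≡ true → S l

∈⇒⟦⟧ : ∀ ls {l} → l ∈ ls → ⟦ ls ⟧ l ≡ true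
∈⇒⟦⟧ _ {l} (here refl) rewrite ==-refl l = refl
∈⇒⟦⟧ (k ∷ ls) {l} (there l∈ls) rewrite ∈⇒⟦⟧ ls l∈ls with l == k
... | true  = refl
... | false = refl

⟦⟧-⊆ : ∀ ls → ⟦ ls ⟧ ⊆ (_∈ ls)
⟦⟧-⊆ (k ∷ ls) l l∈ with l == k in eq
... | true  = here (==⇒≡ l k eq)
... | false = there (⟦⟧-⊆ ls l l∈)

resolvent-⊆ : ∀ {C₁ C₂ x S₁ S₂ T} → C₁ ⊆ S₁ → C₂ ⊆ S₂ →
  (∀ {l} → S₁ l → l ≢ pos x → T l) → (∀ {l} → S₂ l → l ≢ neg x → T l) →
  resolvent C₁ C₂ x ⊆ T
resolvent-⊆ {C₁} {C₂} {x} C₁⊆ C₂⊆ from₁ from₂ l l∈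
  with C₁ l in e₁ | l == pos x in x₁ | C₂ l in e₂ | l == neg x in x₂
... | true | false | _    | _     = from₁ (C₁⊆ l e₁) (==-false⇒≢ x₁)
... | _    | _     | true | false = from₂ (C₂⊆ l e₂) (==-false⇒≢ x₂)
resolvent-⊆ _ _ _ _ _ () | false | _    | false | _
resolvent-⊆ _ _ _ _ _ () | false | _    | true  | true
resolvent-⊆ _ _ _ _ _ () | true  | true | false | _
resolvent-⊆ _ _ _ _ _ () | true  | true | true  | true

resolvent-keepˡ : ∀ C₁ C₂ x {l} → C₁ l ≡ true → l ≢ pos x → resolvent C₁ C₂ x l ≡ true
resolvent-keepˡ _ _ x {l} l∈ l≢x rewrite l∈ | ≢⇒==-false l (pos x) l≢x = refl

resolvent-keepʳ : ∀ C₁ C₂ x {l} → C₂ l ≡ true → l ≢ neg x → resolvent C₁ C₂ x l ≡ true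
resolvent-keepʳ C₁ _ x {l} l∈ l≢x rewrite l∈ | ≢⇒==-false l (neg x) l≢x
  with C₁ l ∧ not (l == pos x)
... | true  = refl
... | false = refl

remove-⊆ : ∀ {C k S T} → C ⊆ S → (∀ {l} → S l → l ≢ k → T l) → remove C k ⊆ T
remove-⊆ {C} {k} C⊆ from l l∈ with C l in e | l == k in lk
... | true | false = from (C⊆ l e) (==-false⇒≢ lk)
remove-⊆ _ _ _ () | true  | true
remove-⊆ _ _ _ () | false | _

remove-keep : ∀ C k {l} → C l ≡ true → l ≢ k → remove C k l ≡ true
remove-keep _ k {l} l∈ l≢k rewrite l∈ | ≢⇒==-false l k l≢k = refl

Consistent : (Lit → Set) → Set
Consistent S = ∀ {v} → S (pos v) → S (neg v) → ⊥

⊆-Consistent⇒¬Tautology : ∀ {C S} → C ⊆ S → Consistent S → ¬ Tautology C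
⊆-Consistent⇒¬Tautology C⊆ consistent (_ , p , n) = consistent (C⊆ _ p) (C⊆ _ n)

⊆⊥⇒Empty : ∀ {C} → C ⊆ (λ _ → ⊥) → Empty C
⊆⊥⇒Empty {C} C⊆ l with C l in e
... | true  = ⊥-elim (C⊆ l e)
... | false = refl

Derivable : Prefix → CNF → ℕ → Clause → Set
Derivable P φ k C = Σ (List Clause) λ cs → Deriv P φ cs k × C ∈ cs

module _ {P : Prefix} {φ : CNF} where

  Deriv-++ : ∀ {cs ds k l} → Deriv P φ cs k → Deriv P φ ds l → Deriv P φ (ds ++ cs) (l + k)
  Deriv-++ dcs []                = dcs
  Deriv-++ dcs (axm C d ax)      = axm C (Deriv-++ dcs d) ax
  Deriv-++ dcs (res C d C₁ C₂ x C₁∈ C₂∈ ∃x x∈ x̄∈ ¬taut eq) =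
    res C (Deriv-++ dcs d) C₁ C₂ x (∈-++⁺ˡ C₁∈) (∈-++⁺ˡ C₂∈) ∃x x∈ x̄∈ ¬taut eq
  Deriv-++ dcs (red C d C₁ l C₁∈ ∀l l∈ l̄∉ before eq) =
    red C (Deriv-++ dcs d) C₁ l (∈-++⁺ˡ C₁∈) ∀l l∈ l̄∉ before eq

  axiom : ∀ {D} → D ∈ φ → Derivable P φ 0 ⟦ D ⟧
  axiom {D} D∈φ = ⟦ D ⟧ ∷ [] , axm ⟦ D ⟧ [] (D , D∈φ , λ _ → refl) , here refl

  resolve : ∀ {k₁ k₂ C₁ C₂ x} → Derivable P φ k₁ C₁ → Derivable P φ k₂ C₂ →
    quantOf P x ≡ just ∃q → C₁ (pos x) ≡ true → C₂ (neg x) ≡ true →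
    ¬ Tautology (resolvent C₁ C₂ x) → Derivable P φ (suc (k₁ + k₂)) (resolvent C₁ C₂ x)
  resolve {C₁ = C₁} {C₂} {x} (cs₁ , d₁ , C₁∈) (_ , d₂ , C₂∈) ∃x x∈ x̄∈ ¬taut =
    _ , res _ (Deriv-++ d₂ d₁) C₁ C₂ x (∈-++⁺ˡ C₁∈) (∈-++⁺ʳ cs₁ C₂∈) ∃x x∈ x̄∈ ¬taut
              (λ _ → refl)
      , here refl

  reduce : ∀ {k C l} → Derivable P φ k C → quantOf P (var l) ≡ just ∀q →
    C l ≡ true → C (comp l) ≡ false →
    (∀ e → quantOf P (var e) ≡ just ∃q → remove C l e ≡ true → var e < var l) →
    Derivable P φ (suc k) (remove C l)
  reduce {C = C} {l} (_ , d , C∈) ∀l l∈ l̄∉ before =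
    _ , red _ d C l C∈ ∀l l∈ l̄∉ before (λ _ → refl) , here refl

  Derivable⇒Refutation : ∀ {s C} → Derivable P φ s C → Empty C → Refutation P φ s
  Derivable⇒Refutation (cs , d , C∈) empty = cs , d , lose C∈ empty

quantOf-++ˡ : ∀ qs rs {i} → i < length qs → quantOf (qs ++ rs) i ≡ quantOf qs i
quantOf-++ˡ (q ∷ qs) rs {zero}  _         = refl
quantOf-++ˡ (q ∷ qs) rs {suc i} (s≤s i<) = quantOf-++ˡ qs rs i<

quantOf-++ʳ : ∀ qs rs i → quantOf (qs ++ rs) (length qs + i) ≡ quantOf rs i
quantOf-++ʳ []       rs i = refl
quantOf-++ʳ (q ∷ qs) rs i = quantOf-++ʳ qs rs i

quantOf-replicate : ∀ {n i} q → i < n → quantOf (replicate n q) i ≡ just q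
quantOf-replicate {suc n} {zero}  q _        = refl
quantOf-replicate {suc n} {suc i} q (s≤s i<) = quantOf-replicate q i<

module _ {A : Set} (bs : Prefix) where

  blocks : List A → Prefix
  blocks = concatMap (λ _ → bs)

  quantOf-blocks : ∀ xs rs {i r} → i < length xs → r < length bs →
    quantOf (blocks xs ++ rs) (length bs * i + r) ≡ quantOf bs r
  quantOf-blocks (x ∷ xs) rs {zero} {r} _ r< = begin
    quantOf (blocks (x ∷ xs) ++ rs) (length bs * 0 + r)
      ≡⟨ cong (λ t → quantOf (blocks (x ∷ xs) ++ rs) (t + r)) (*-zeroʳ (length bs)) ⟩
    quantOf ((bs ++ blocks xs) ++ rs) r
      ≡⟨ cong (λ qs → quantOf qs r) (++-assoc bs (blocks xs) rs) ⟩
    quantOf (bs ++ blocks xs ++ rs) r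
      ≡⟨ quantOf-++ˡ bs _ r< ⟩
    quantOf bs r
      ∎
    where open ≡-Reasoning
  quantOf-blocks (x ∷ xs) rs {suc i} {r} (s≤s i<) r< = begin
    quantOf (blocks (x ∷ xs) ++ rs) (length bs * suc i + r)
      ≡⟨ cong (λ t → quantOf (blocks (x ∷ xs) ++ rs) (t + r)) (*-suc (length bs) i) ⟩
    quantOf ((bs ++ blocks xs) ++ rs) (length bs + length bs * i + r)
      ≡⟨ cong₂ quantOf (++-assoc bs (blocks xs) rs) (+-assoc (length bs) _ r) ⟩
    quantOf (bs ++ blocks xs ++ rs) (length bs + (length bs * i + r))
      ≡⟨ quantOf-++ʳ bs _ _ ⟩
    quantOf (blocks xs ++ rs) (length bs * i + r)
      ≡⟨ quantOf-blocks xs rs i< r< ⟩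
    quantOf bs r
      ∎
    where open ≡-Reasoning

  quantOf-after-blocks : ∀ xs rs i →
    quantOf (blocks xs ++ rs) (length bs * length xs + i) ≡ quantOf rs i
  quantOf-after-blocks [] rs i = cong (λ t → quantOf rs (t + i)) (*-zeroʳ (length bs))
  quantOf-after-blocks (x ∷ xs) rs i = begin
    quantOf ((bs ++ blocks xs) ++ rs) (length bs * suc (length xs) + i)
      ≡⟨ cong₂ quantOf (++-assoc bs (blocks xs) rs)
                       (trans (cong (_+ i) (*-suc (length bs) (length xs))) (+-assoc (length bs) _ i)) ⟩
    quantOf (bs ++ blocks xs ++ rs) (length bs + (length bs * length xs + i)) ≡⟨ quantOf-++ʳ bs _ _ ⟩
    quantOf (blocks xs ++ rs) (length bs * length xs + i)                 ≡⟨ quantOf-after-blocks xs rs i ⟩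
    quantOf rs i                                                          ∎
    where open ≡-Reasoning

*+<* : ∀ k {i j r} → i < j → r < k → k * i + r < k * j
*+<* k {i} {j} {r} i<j r<k = begin-strict
  k * i + r   <⟨ +-monoʳ-< (k * i) r<k ⟩
  k * i + k   ≡⟨ +-comm (k * i) k ⟩
  k + k * i   ≡⟨ *-suc k i ⟨
  k * suc i   ≤⟨ *-monoʳ-≤ k i<j ⟩
  k * j       ∎
  where open ≤-Reasoning

*+-injective : ∀ k {i j r s} → r < k → s < k → k * i + r ≡ k * j + s → i ≡ j × r ≡ s
*+-injective k {i} {j} r<k s<k eq with <-cmp i j
... | tri< i<j _ _ = ⊥-elim (<⇒≢ (<-≤-trans (*+<* k i<j r<k) (m≤m+n (k * j) _)) eq)
... | tri> _ _ j<i = ⊥-elim (<⇒≢ (<-≤-trans (*+<* k j<i s<k) (m≤m+n (k * i) _)) (sym eq))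
... | tri≈ _ refl _ = refl , +-cancelˡ-≡ (k * i) _ _ eq

xv≢av : ∀ i j → xv i ≢ av j
xv≢av i j eq with () ← proj₂ (*+-injective 3 {i} {j} {r = 0} z<s (n<1+n 2) (trans (+-identityʳ (3 * i)) eq))

av≢yv : ∀ i j → av i ≢ yv j
av≢yv i j eq with () ← proj₂ (*+-injective 3 {i} {j} (n<1+n 2) (s<s z<s) eq)

xv-injective : ∀ {i j} → xv i ≡ xv j → i ≡ j
xv-injective {i} {j} = *-cancelˡ-≡ i j 3

xv<av : ∀ {i j} → i ≤ j → xv i < av j
xv<av {j = j} i≤j = ≤-<-trans (*-monoʳ-≤ 3 i≤j) (m<m+n (3 * j) z<s)

xv<zv : ∀ {n i} k → i < n → xv i < zv n k
xv<zv {n} {i} k i<n =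
  <-≤-trans (subst (_< 3 * n) (+-identityʳ (3 * i)) (*+<* 3 i<n z<s)) (m≤m+n (3 * n) k)

av<zv : ∀ {n i} k → i < n → av i < zv n k
av<zv {n} k i<n = <-≤-trans (*+<* 3 i<n (n<1+n 2)) (m≤m+n (3 * n) k)

descent-steps : ∀ e m → suc (suc (3 * e + suc (suc m) + 1)) ≡ 3 * suc e + suc (suc m)
descent-steps = solve-∀

total-steps : ∀ m → suc (3 * m + suc (suc m) + 1) ≡ 4 * suc m
total-steps = solve-∀

module KBKF (m : ℕ) where

  n : ℕ
  n = suc m

  P : Prefix
  P = kbkfPrefix n

  φ : CNF
  φ = kbkfMatrix n ++ psi n

  block : Prefix
  block = ∃q ∷ ∃q ∷ ∀q ∷ []

  quantOf-block : ∀ {i r} → i < n → r < 3 → quantOf P (3 * i + r) ≡ quantOf block r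
  quantOf-block {i} i<n r<3 =
    quantOf-blocks block (upTo n) (replicate n ∃q) (subst (i <_) (sym (length-upTo n)) i<n) r<3

  x-∃ : ∀ {i} → i < n → quantOf P (xv i) ≡ just ∃q
  x-∃ {i} i<n = subst (λ v → quantOf P v ≡ just ∃q) (+-identityʳ (3 * i)) (quantOf-block i<n z<s)

  y-∃ : ∀ {i} → i < n → quantOf P (yv i) ≡ just ∃q
  y-∃ i<n = quantOf-block i<n (s<s z<s)

  a-∀ : ∀ {i} → i < n → quantOf P (av i) ≡ just ∀q
  a-∀ i<n = quantOf-block i<n (n<1+n 2)

  z-∃ : ∀ {i} → i < n → quantOf P (zv n i) ≡ just ∃q
  z-∃ {i} i<n = begin
    quantOf P (3 * n + i)                ≡⟨ cong (λ t → quantOf P (3 * t + i)) (length-upTo n) ⟨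
    quantOf P (3 * length (upTo n) + i)  ≡⟨ quantOf-after-blocks block (upTo n) (replicate n ∃q) i ⟩
    quantOf (replicate n ∃q) i           ≡⟨ quantOf-replicate ∃q i<n ⟩
    just ∃q                              ∎
    where open ≡-Reasoning

  -- With the 0-based indices of Defs: C-even j, C-odd j are C_{2j+2}, C_{2j+3}; C-last is C_{2n};
  -- B-odd i, B-even i are B_{2i+1}, B_{2i+2}; and ψ i is x̄_{i+1} ∨ y_{i+1}.
  C₁ C-last : InClause
  C₁     = neg (xv 0) ∷ neg (yv 0) ∷ []
  C-last = pos (xv m) ∷ neg (av m) ∷ negZs n

  C-even C-odd B-odd B-even ψ : ℕ → InClause
  C-even j = pos (xv j) ∷ neg (av j) ∷ neg (xv (suc j)) ∷ neg (yv (suc j)) ∷ []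
  C-odd j  = pos (yv j) ∷ pos (av j) ∷ neg (xv (suc j)) ∷ neg (yv (suc j)) ∷ []
  B-odd i  = pos (av i) ∷ pos (zv n i) ∷ []
  B-even i = neg (av i) ∷ pos (zv n i) ∷ []
  ψ i      = neg (xv i) ∷ pos (yv i) ∷ []

  C-pairs : CNF
  C-pairs = concatMap (λ j → C-even j ∷ C-odd j ∷ []) (upTo m)

  ∈matrix⇒∈φ : ∀ {D} → D ∈ kbkfMatrix n → D ∈ φ
  ∈matrix⇒∈φ = ∈-++⁺ˡ

  C₁∈φ : C₁ ∈ φ
  C₁∈φ = ∈matrix⇒∈φ (here refl)

  C-even∈φ : ∀ {j} → j < m → C-even j ∈ φ
  C-even∈φ j<m = ∈matrix⇒∈φ (there (∈-++⁺ˡ (∈-concatMap⁺ (λ j → C-even j ∷ C-odd j ∷ [])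
    (Any.map (λ { refl → here refl }) (∈-upTo⁺ j<m)))))

  C-last∈φ : C-last ∈ φ
  C-last∈φ = ∈matrix⇒∈φ (there (∈-++⁺ʳ C-pairs (here refl)))

  B-even∈φ : ∀ {i} → i < n → B-even i ∈ φ
  B-even∈φ i<n = ∈matrix⇒∈φ (there (∈-++⁺ʳ C-pairs (there (there
    (∈-concatMap⁺ (λ i → B-odd i ∷ B-even i ∷ [])
      (Any.map (λ { refl → there (here refl) }) (∈-upTo⁺ i<n)))))))

  ψ∈φ : ∀ {i} → i < n → ψ i ∈ φ
  ψ∈φ i<n = ∈-++⁺ʳ (kbkfMatrix n) (∈-map⁺ ψ (∈-upTo⁺ i<n))

  -- Shape p q k bounds the clause x_{p+1} ∨ ā_1 ∨ ⋯ ∨ ā_q ∨ z̄_{k+1} ∨ ⋯ ∨ z̄_n (paper indices).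
  Shape : ℕ → ℕ → ℕ → Lit → Set
  Shape p q k (pos v) = v ≡ xv p
  Shape p q k (neg v) = (∃[ i ] i < q × v ≡ av i) ⊎ (∃[ i ] k ≤ i × i < n × v ≡ zv n i)

  Shape-consistent : ∀ {p q k} → p < n → Consistent (Shape p q k)
  Shape-consistent {p} p<n refl (inj₁ (i , _ , eq))     = xv≢av p i eq
  Shape-consistent {p} p<n refl (inj₂ (i , _ , _ , eq)) = <⇒≢ (xv<zv i p<n) eq

  Shape-∃ : ∀ {p q l} → q ≤ n → Shape p q n l → quantOf P (var l) ≡ just ∃q → l ≡ pos (xv p)
  Shape-∃ {l = pos v} _ refl _ = refl
  Shape-∃ {l = neg v} q≤n (inj₁ (i , i<q , refl)) ∃l with () ← trans (sym (a-∀ (<-≤-trans i<q q≤n))) ∃l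
  Shape-∃ {l = neg v} _ (inj₂ (i , n≤i , i<n , _)) _ = ⊥-elim (<⇒≱ i<n n≤i)

  Reaches : ℕ → ℕ → ℕ → Set
  Reaches s p q = Σ Clause λ C → Derivable P φ s C × C ⊆ Shape p q n × C (pos (xv p)) ≡ true

  reduce-ā : ∀ {s p q C} → p ≤ q → q < n → Derivable P φ s C → C ⊆ Shape p (suc q) n →
    C (pos (xv p)) ≡ true → C (neg (av q)) ≡ true → Reaches (suc s) p q
  reduce-ā {s} {p} {q} {C} p≤q q<n dC C⊆ x∈C ā∈C =
    remove C (neg (av q)) , reduce dC (a-∀ q<n) ā∈C a∉C before , R⊆ , remove-keep C (neg (av q)) x∈C (λ ())
    where
    drop-ā : ∀ {l} → Shape p (suc q) n l → l ≢ neg (av q) → Shape p q n l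
    drop-ā {pos v} x _                          = x
    drop-ā {neg v} (inj₁ (i , s≤s i≤q , refl)) l≢ā =
      inj₁ (i , ≤∧≢⇒< i≤q (λ { refl → l≢ā refl }) , refl)
    drop-ā {neg v} (inj₂ z) _                   = inj₂ z

    R⊆ : remove C (neg (av q)) ⊆ Shape p q n
    R⊆ = remove-⊆ C⊆ drop-ā

    a∉C : C (pos (av q)) ≡ false
    a∉C with C (pos (av q)) in a∈C
    ... | true  = ⊥-elim (xv≢av p q (sym (C⊆ _ a∈C)))
    ... | false = refl

    before : ∀ e → quantOf P (var e) ≡ just ∃q → remove C (neg (av q)) e ≡ true → var e < av q
    before e ∃e e∈R with refl ← Shape-∃ (<⇒≤ q<n) (R⊆ e e∈R) ∃e = xv<av p≤q

  ZResolved : ℕ → Set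
  ZResolved k = Σ Clause λ C → Derivable P φ k C × C ⊆ Shape m n k
    × C (pos (xv m)) ≡ true × C (neg (av m)) ≡ true
    × (∀ {i} → k ≤ i → i < n → C (neg (zv n i)) ≡ true)

  C-last-ZResolved : ZResolved 0
  C-last-ZResolved =
    ⟦ C-last ⟧ , axiom C-last∈φ , C-last⊆ , ∈⇒⟦⟧ C-last (here refl) , ∈⇒⟦⟧ C-last (there (here refl)) ,
    λ _ i<n → ∈⇒⟦⟧ C-last (there (there (∈-map⁺ (λ i → neg (zv n i)) (∈-upTo⁺ i<n))))
    where
    C-last⊆ : ⟦ C-last ⟧ ⊆ Shape m n 0
    C-last⊆ l l∈ with ⟦⟧-⊆ C-last l l∈
    ... | here refl         = refl
    ... | there (here refl) = inj₁ (m , n<1+n m , refl)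
    ... | there (there z̄∈) with i , i∈ , refl ← ∈-map⁻ (λ i → neg (zv n i)) z̄∈ =
      inj₂ (i , z≤n , ∈-upTo⁻ i∈ , refl)

  resolve-z : ∀ {k} → k < n → ZResolved k → ZResolved (suc k)
  resolve-z {k} k<n (C , dC , C⊆ , x∈C , ā∈C , z̄∈C) =
    R , resolve (axiom (B-even∈φ k<n)) dC (z-∃ k<n) (∈⇒⟦⟧ (B-even k) (there (here refl))) (z̄∈C ≤-refl k<n)
                (⊆-Consistent⇒¬Tautology R⊆ (Shape-consistent (n<1+n m))) ,
    R⊆ , keep x∈C (λ ()) , keep ā∈C (λ eq → <⇒≢ (av<zv k (n<1+n m)) (neg-injective eq)) ,
    λ k<i i<n → keep (z̄∈C (<⇒≤ k<i) i<n) (λ eq → <⇒≢ k<i (sym (zv-injective (neg-injective eq))))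
    where
    R : Clause
    R = resolvent ⟦ B-even k ⟧ C (zv n k)

    keep : ∀ {l} → C l ≡ true → l ≢ neg (zv n k) → R l ≡ true
    keep = resolvent-keepʳ ⟦ B-even k ⟧ C (zv n k)

    zv-injective : ∀ {i j} → zv n i ≡ zv n j → i ≡ j
    zv-injective = +-cancelˡ-≡ (3 * n) _ _

    fromB : ∀ {l} → l ∈ B-even k → l ≢ pos (zv n k) → Shape m n (suc k) l
    fromB (here refl)         _   = inj₁ (k , k<n , refl)
    fromB (there (here refl)) l≢z = ⊥-elim (l≢z refl)

    fromC : ∀ {l} → Shape m n k l → l ≢ neg (zv n k) → Shape m n (suc k) l
    fromC {pos v} x _ = x
    fromC {neg v} (inj₁ ā) _ = inj₁ ā
    fromC {neg v} (inj₂ (i , k≤i , i<n , refl)) l≢z̄ =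
      inj₂ (i , ≤∧≢⇒< k≤i (λ { refl → l≢z̄ refl }) , i<n , refl)

    R⊆ : R ⊆ Shape m n (suc k)
    R⊆ = resolvent-⊆ (⟦⟧-⊆ (B-even k)) C⊆ fromB fromC

  all-z-resolved : ∀ k → k ≤ n → ZResolved k
  all-z-resolved zero    _   = C-last-ZResolved
  all-z-resolved (suc k) k<n = resolve-z k<n (all-z-resolved k (<⇒≤ k<n))

  ψ-C-even : ℕ → Clause
  ψ-C-even j = resolvent ⟦ ψ (suc j) ⟧ ⟦ C-even j ⟧ (yv (suc j))

  ψ-C-even-lits : ℕ → List Lit
  ψ-C-even-lits j = pos (xv j) ∷ neg (av j) ∷ neg (xv (suc j)) ∷ []

  ψ-C-even-⊆ : ∀ j → ψ-C-even j ⊆ (_∈ ψ-C-even-lits j)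
  ψ-C-even-⊆ j = resolvent-⊆ (⟦⟧-⊆ (ψ (suc j))) (⟦⟧-⊆ (C-even j)) fromψ fromC
    where
    fromψ : ∀ {l} → l ∈ ψ (suc j) → l ≢ pos (yv (suc j)) → l ∈ ψ-C-even-lits j
    fromψ (here refl)         _   = there (there (here refl))
    fromψ (there (here refl)) l≢y = ⊥-elim (l≢y refl)

    fromC : ∀ {l} → l ∈ C-even j → l ≢ neg (yv (suc j)) → l ∈ ψ-C-even-lits j
    fromC (here refl)                         _   = here refl
    fromC (there (here refl))                 _   = there (here refl)
    fromC (there (there (here refl)))         _   = there (there (here refl))
    fromC (there (there (there (here refl)))) l≢ȳ = ⊥-elim (l≢ȳ refl)

  ψ-C-even-∋ : ∀ {j l} → l ∈ ψ-C-even-lits j → ψ-C-even j l ≡ true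
  ψ-C-even-∋ {j} (here refl) =
    resolvent-keepʳ ⟦ ψ (suc j) ⟧ ⟦ C-even j ⟧ (yv (suc j)) {pos (xv j)}
      (∈⇒⟦⟧ (C-even j) (here refl)) (λ ())
  ψ-C-even-∋ {j} (there (here refl)) =
    resolvent-keepʳ ⟦ ψ (suc j) ⟧ ⟦ C-even j ⟧ (yv (suc j)) {neg (av j)}
      (∈⇒⟦⟧ (C-even j) (there (here refl)))
      (λ eq → av≢yv j (suc j) (neg-injective eq))
  ψ-C-even-∋ {j} (there (there (here refl))) =
    resolvent-keepˡ ⟦ ψ (suc j) ⟧ ⟦ C-even j ⟧ (yv (suc j)) {neg (xv (suc j))}
      (∈⇒⟦⟧ (ψ (suc j)) (here refl)) (λ ())

  ψ-C-even-derivable : ∀ {j} → j < m → Derivable P φ 1 (ψ-C-even j)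
  ψ-C-even-derivable {j} j<m =
    resolve (axiom (ψ∈φ (s≤s j<m))) (axiom (C-even∈φ j<m)) (y-∃ (s≤s j<m))
      (∈⇒⟦⟧ (ψ (suc j)) (there (here refl))) (∈⇒⟦⟧ (C-even j) (there (there (there (here refl)))))
      (⊆-Consistent⇒¬Tautology (ψ-C-even-⊆ j) consistent)
    where
    consistent : Consistent (_∈ ψ-C-even-lits j)
    consistent (here refl) (there (here eq))         = xv≢av j j (neg-injective eq)
    consistent (here refl) (there (there (here eq))) = 1+n≢n (sym (xv-injective (neg-injective eq)))
    consistent (there (here ()))         _
    consistent (there (there (here ()))) _

  descend-step : ∀ {s j} → j < m → Reaches s (suc j) (suc j) → Reaches (suc (suc (s + 1))) j j
  descend-step {s} {j} j<m (D , dD , D⊆ , x∈D) =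
    reduce-ā ≤-refl j<n
      (resolve dD (ψ-C-even-derivable j<m) (x-∃ (s≤s j<m)) x∈D (ψ-C-even-∋ {j} (there (there (here refl))))
        (⊆-Consistent⇒¬Tautology G⊆ (Shape-consistent j<n)))
      G⊆ (keep (ψ-C-even-∋ {j} (here refl)) (λ ()))
      (keep (ψ-C-even-∋ {j} (there (here refl))) (λ eq → xv≢av (suc j) j (sym (neg-injective eq))))
    where
    j<n : j < n
    j<n = m<n⇒m<1+n j<m

    G : Clause
    G = resolvent D (ψ-C-even j) (xv (suc j))

    keep : ∀ {l} → ψ-C-even j l ≡ true → l ≢ neg (xv (suc j)) → G l ≡ true
    keep = resolvent-keepʳ D (ψ-C-even j) (xv (suc j))

    fromD : ∀ {l} → Shape (suc j) (suc j) n l → l ≢ pos (xv (suc j)) → Shape j (suc j) n l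
    fromD {pos v} refl l≢x = ⊥-elim (l≢x refl)
    fromD {neg v} ā     _  = ā

    fromF : ∀ {l} → l ∈ ψ-C-even-lits j → l ≢ neg (xv (suc j)) → Shape j (suc j) n l
    fromF (here refl)                 _   = refl
    fromF (there (here refl))         _   = inj₁ (j , n<1+n j , refl)
    fromF (there (there (here refl))) l≢x̄ = ⊥-elim (l≢x̄ refl)

    G⊆ : G ⊆ Shape j (suc j) n
    G⊆ = resolvent-⊆ D⊆ (ψ-C-even-⊆ j) fromD fromF

  descend : ∀ e {j} → e + j ≡ m → Reaches (3 * e + suc n) j j
  descend zero refl with C , dC , C⊆ , x∈C , ā∈C , _ ← all-z-resolved n ≤-refl =
    reduce-ā ≤-refl (n<1+n m) dC C⊆ x∈C ā∈C
  descend (suc e) {j} e+j≡m =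
    subst (λ s → Reaches s j j) (descent-steps e m)
      (descend-step j<m (descend e (trans (+-suc e j) e+j≡m)))
    where
    j<m : j < m
    j<m = subst (j <_) e+j≡m (m<n+m j z<s)

  ψ-C₁ : Clause
  ψ-C₁ = resolvent ⟦ ψ 0 ⟧ ⟦ C₁ ⟧ (yv 0)

  ψ-C₁-⊆ : ψ-C₁ ⊆ (_≡ neg (xv 0))
  ψ-C₁-⊆ = resolvent-⊆ (⟦⟧-⊆ (ψ 0)) (⟦⟧-⊆ C₁) fromψ fromC₁
    where
    fromψ : ∀ {l} → l ∈ ψ 0 → l ≢ pos (yv 0) → l ≡ neg (xv 0)
    fromψ (here refl)         _   = refl
    fromψ (there (here refl)) l≢y = ⊥-elim (l≢y refl)

    fromC₁ : ∀ {l} → l ∈ C₁ → l ≢ neg (yv 0) → l ≡ neg (xv 0)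
    fromC₁ (here refl)         _   = refl
    fromC₁ (there (here refl)) l≢ȳ = ⊥-elim (l≢ȳ refl)

  ψ-C₁-derivable : Derivable P φ 1 ψ-C₁
  ψ-C₁-derivable = resolve (axiom (ψ∈φ z<s)) (axiom C₁∈φ) (y-∃ z<s) refl refl
    (⊆-Consistent⇒¬Tautology ψ-C₁-⊆ λ ())

  refute : ∀ {s} → Reaches s 0 0 → Refutation P φ (suc (s + 1))
  refute (D , dD , D⊆ , x∈D) =
    Derivable⇒Refutation
      (resolve dD ψ-C₁-derivable (x-∃ z<s) x∈D refl (⊆-Consistent⇒¬Tautology E⊆ λ ()))
      (⊆⊥⇒Empty E⊆)
    where
    fromD : ∀ {l} → Shape 0 0 n l → l ≢ pos (xv 0) → ⊥
    fromD {pos v} refl l≢x = l≢x refl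
    fromD {neg v} (inj₂ (i , n≤i , i<n , _)) _ = <⇒≱ i<n n≤i

    fromH : ∀ {l} → l ≡ neg (xv 0) → l ≢ neg (xv 0) → ⊥
    fromH refl l≢x̄ = l≢x̄ refl

    E⊆ : resolvent D ψ-C₁ (xv 0) ⊆ (λ _ → ⊥)
    E⊆ = resolvent-⊆ D⊆ ψ-C₁-⊆ fromD fromH

  refutation : Refutation P φ (4 * n)
  refutation = subst (Refutation P φ) (total-steps m) (refute (descend m (+-identityʳ m)))

mainTheorem1 : (n : ℕ) → 1 ≤ n →
    Σ ℕ λ s → (s ≤ 4 * n) × Refutation (kbkfPrefix n) (kbkfMatrix n ++ psi n) s
mainTheorem1 (suc m) _ = 4 * suc m , ≤-refl , KBKF.refutation m
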